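{- Let $p$ be a prime and let $G=\Gamma(\mathbb{Z}_{p}[x]/\langle x^{4}\rangle)$ be the zero divisor graph of $\mathbb{Z}_{p}[x]/\langle x^{4}\rangle$. Then: (i) $G$ is singular, i.e. $\det A(G)=0$, where $A(G)$ is the adjacency matrix of $G$; (ii) for $p\geq 3$, $G$ does not have all of its adjacency eigenvalues simple, i.e. some adjacency eigenvalue of $G$ has multiplicity at least $2$.
   Context: For a commutative ring $R$ with nonzero identity, the zero divisor graph $\Gamma(R)$ is the simple graph whose vertex set is the set of nonzero zero divisors of $R$, two distinct vertices $x,y$ being adjacent if and only if $x\cdot y=0$. An eigenvalue is simple if it has multiplicity one. -}

module Defs where

open import Level using (Level; _⊔_; 0ℓ) renaming (suc to lsuc)
open import Data.Nat using (ℕ; zero; suc; NonZero) renaming (_+_ to _+ℕ_; _*_ to _*ℕ_)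
open import Data.Nat.DivMod using (_mod_)
open import Data.Fin using (Fin; zero; suc; toℕ; punchIn)
open import Data.Fin.Properties using () renaming (_≟_ to _≟F_)
open import Data.Vec using (Vec; []; _∷_; replicate)
open import Data.Vec.Properties using (≡-dec)
open import Data.Integer using (ℤ; +_; -_) renaming (_+_ to _+ℤ_; _*_ to _*ℤ_)
open import Data.Bool using (Bool; true; false; if_then_else_; _∧_; not)
open import Data.Product using (Σ; ∃; _×_; _,_)
open import Relation.Nullary using (¬_; Dec; does)
open import Relation.Binary.PropositionalEquality using (_≡_; _≢_)
open import Algebra.Bundles using (CommutativeRing)
open import Function.Definitions using (Injective)

-- The ring ℤ_p[x]/⟨x⁴⟩.  An element a₀ + a₁x + a₂x² + a₃x³ is the
-- vector of its coefficients (a₀ ∷ a₁ ∷ a₂ ∷ a₃ ∷ []) in ℤ_p = Fin p.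

R : (p : ℕ) → Set
R p = Vec (Fin p) 4

module _ (p : ℕ) .{{_ : NonZero p}} where

  ⟦_⟧ : ℕ → Fin p
  ⟦ n ⟧ = n mod p

  0R : R p
  0R = replicate 4 ⟦ 0 ⟧

  -- product of polynomials, truncated at x⁴ (since x⁴ = 0), coefficients mod p
  mulR : R p → R p → R p
  mulR (a₀ ∷ a₁ ∷ a₂ ∷ a₃ ∷ []) (b₀ ∷ b₁ ∷ b₂ ∷ b₃ ∷ []) =
      ⟦ t a₀ *ℕ t b₀ ⟧
    ∷ ⟦ t a₀ *ℕ t b₁ +ℕ t a₁ *ℕ t b₀ ⟧
    ∷ ⟦ t a₀ *ℕ t b₂ +ℕ t a₁ *ℕ t b₁ +ℕ t a₂ *ℕ t b₀ ⟧
    ∷ ⟦ t a₀ *ℕ t b₃ +ℕ t a₁ *ℕ t b₂ +ℕ t a₂ *ℕ t b₁ +ℕ t a₃ *ℕ t b₀ ⟧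
    ∷ []
    where
    t : Fin p → ℕ
    t = toℕ

  IsZeroDivisor : R p → Set
  IsZeroDivisor z = ∃ λ y → y ≢ 0R × mulR z y ≡ 0R

  IsVertex : R p → Set
  IsVertex z = z ≢ 0R × IsZeroDivisor z

  _≟R_ : (x y : R p) → Dec (x ≡ y)
  _≟R_ = ≡-dec _≟F_

  Enumerates : (n : ℕ) → (Fin n → R p) → Set
  Enumerates n e = Injective _≡_ _≡_ e
                 × (∀ i → IsVertex (e i))
                 × (∀ z → IsVertex z → ∃ λ i → e i ≡ z)

  adj : {n : ℕ} → (Fin n → R p) → Fin n → Fin n → Bool
  adj e i j = not (does (i ≟F j)) ∧ does (mulR (e i) (e j) ≟R 0R)

sumℤ : ∀ {n} → (Fin n → ℤ) → ℤ
sumℤ {zero}  f = + 0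
sumℤ {suc n} f = f zero +ℤ sumℤ (λ i → f (suc i))

signℤ : ℕ → ℤ
signℤ zero = + 1
signℤ (suc k) = - signℤ k

det : ∀ n → (Fin n → Fin n → ℤ) → ℤ
det zero    M = + 1
det (suc n) M = sumℤ λ j →
  signℤ (toℕ j) *ℤ M zero j *ℤ det n (λ i k → M (suc i) (punchIn j k))

adjMatrixℤ : (p : ℕ) .{{_ : NonZero p}} → {n : ℕ} → (Fin n → R p) → Fin n → Fin n → ℤ
adjMatrixℤ p e i j = if adj p e i j then + 1 else + 0

record Field (c ℓ : Level) : Set (lsuc (c ⊔ ℓ)) where
  field
    commutativeRing : CommutativeRing c ℓ
  open CommutativeRing commutativeRing
  field
    1≉0     : ¬ (1# ≈ 0#)
    inverse : ∀ x → ¬ (x ≈ 0#) → ∃ λ y → x * y ≈ 1#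
  open CommutativeRing commutativeRing public

module FieldOps {c ℓ} (K : Field c ℓ) where
  open Field K using (Carrier; _≈_; _+_; _*_; 0#; 1#)

  _×1 : ℕ → Carrier
  zero ×1 = 0#
  suc n ×1 = 1# + n ×1

  CharZero : Set ℓ
  CharZero = ∀ n → ¬ (suc n ×1 ≈ 0#)

  sumK : ∀ {n} → (Fin n → Carrier) → Carrier
  sumK {zero}  f = 0#
  sumK {suc n} f = f zero + sumK (λ i → f (suc i))

  mulMV : ∀ {n} → (Fin n → Fin n → Carrier) → (Fin n → Carrier) → Fin n → Carrier
  mulMV M v i = sumK (λ j → M i j * v j)

  InEigenspace : ∀ {n} → (Fin n → Fin n → Carrier) → Carrier → (Fin n → Carrier) → Set ℓ
  InEigenspace M λ' v = ∀ i → mulMV M v i ≈ λ' * v i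

  LinIndep₂ : ∀ {n} → (Fin n → Carrier) → (Fin n → Carrier) → Set (c ⊔ ℓ)
  LinIndep₂ v w = ∀ a b → (∀ i → a * v i + b * w i ≈ 0#) → (a ≈ 0#) × (b ≈ 0#)

  -- λ is an eigenvalue of M of multiplicity ≥ 2 (its eigenspace has
  -- dimension ≥ 2)
  MultEigenvalue : ∀ {n} → (Fin n → Fin n → Carrier) → Carrier → Set (c ⊔ ℓ)
  MultEigenvalue M λ' = ∃ λ v → ∃ λ w →
    InEigenspace M λ' v × InEigenspace M λ' w × LinIndep₂ v w

adjMatrixK : ∀ {c ℓ} (K : Field c ℓ) (p : ℕ) .{{_ : NonZero p}} → {n : ℕ} →
             (Fin n → R p) → Fin n → Fin n → Field.Carrier K
adjMatrixK K p e i j = if adj p e i j then Field.1# K else Field.0# K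

-- Some adjacency eigenvalue has multiplicity ≥ 2, witnessed in a field of
-- characteristic 0 containing that eigenvalue.
HasMultipleEigenvalue : (p : ℕ) .{{_ : NonZero p}} → {n : ℕ} → (Fin n → R p) → Set₁
HasMultipleEigenvalue p e =
  Σ (Field 0ℓ 0ℓ) λ K → FieldOps.CharZero K ×
    ∃ λ (λ' : Field.Carrier K) → FieldOps.MultEigenvalue K (adjMatrixK K p e) λ'

-- In ℤ_p[x]/⟨x⁴⟩ the elements x, x + x³ and x + x² are x times a unit, so
-- each has annihilator ⟨x³⟩ and none of them annihilates another.  They are
-- therefore three distinct vertices of Γ with the same neighbourhood: the
-- adjacency matrix has three equal rows and three equal columns.  Two equal
-- rows force the determinant to vanish, and for equal columns a, b, c the
-- vectors e_b − e_a and e_c − e_a are independent vectors in the kernel, so 0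
-- is an eigenvalue of multiplicity at least 2.
--
-- That a determinant with two equal rows vanishes is derived from the
-- first-row Laplace expansion: expanding along the first two rows shows that
-- exchanging them changes the sign, which settles equal rows 0 and 1 and
-- reduces equal rows 0 and v to two equal rows below row 0; those vanish by
-- induction, since every minor along row 0 inherits them.

module Submission where

open import Defs
open import Algebra.Bundles using (Ring)
import Algebra.Properties.Ring as RingProperties
import Algebra.Properties.Semiring.Sum as SemiringSum
open import Data.Nat using (ℕ; zero; suc; NonZero; _≤_)
open import Data.Nat.Primality using (Prime)
open import Data.Fin using (Fin; zero; suc; toℕ; punchIn; punchOut)
open import Data.Bool using (if_then_else_)
open import Data.Product using (_×_; _,_; proj₁; proj₂)
open import Function using (_∘_)
open import Relation.Nullary using (yes; no; does; contradiction)
open import Relation.Binary.PropositionalEquality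
  using (_≡_; _≢_; refl; sym; trans; cong; cong₂; subst; module ≡-Reasoning)

module _ {c ℓ} (R : Ring c ℓ) where
  open Ring R using (Carrier; _≈_; _*_; -_; 1#; semiring; setoid)
  open SemiringSum semiring using (sum; sum-cong-≋; *-distribˡ-sum)
  open RingProperties R using (-1*x≈-x)
  open import Relation.Binary.Reasoning.Setoid setoid

  neg-sum : ∀ {n} (f : Fin n → Carrier) → sum (λ i → - f i) ≈ - sum f
  neg-sum f = begin
    sum (λ i → - f i)        ≈⟨ sum-cong-≋ (λ i → -1*x≈-x (f i)) ⟨
    sum (λ i → - 1# * f i)   ≈⟨ *-distribˡ-sum (- 1#) f ⟨
    - 1# * sum f             ≈⟨ -1*x≈-x (sum f) ⟩
    - sum f                  ∎

punchIn-punchOut-comm : ∀ {n} {a b : Fin (suc (suc n))} (a≢b : a ≢ b) (b≢a : b ≢ a) (l : Fin n) →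
  punchIn a (punchIn (punchOut a≢b) l) ≡ punchIn b (punchIn (punchOut b≢a) l)
punchIn-punchOut-comm {a = zero}  {zero}  a≢b _ _ = contradiction refl a≢b
punchIn-punchOut-comm {a = zero}  {suc b} _   _ _ = refl
punchIn-punchOut-comm {a = suc a} {zero}  _   _ _ = refl
punchIn-punchOut-comm {n = suc n} {suc a} {suc b} _   _   zero    = refl
punchIn-punchOut-comm {n = suc n} {suc a} {suc b} a≢b b≢a (suc l) =
  cong suc (punchIn-punchOut-comm (a≢b ∘ cong suc) (b≢a ∘ cong suc) l)

module Determinant where
  open import Data.Fin.Properties using (punchInᵢ≢i; punchOut-cong; punchOut-punchIn; _≟_)
  open import Data.Integer using (ℤ; +_; -_; +[1+_]; -[1+_]; _+_; _*_)
  import Data.Integer.Properties as ℤ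
  open import Data.Integer.Tactic.RingSolver using (solve-∀)
  open SemiringSum ℤ.+-*-semiring
    using (sum; sum-cong-≗; sum-remove; ∑-comm; *-distribˡ-sum; sum-replicate-zero)

  Matrix : ℕ → Set
  Matrix n = Fin n → Fin n → ℤ

  sgn : ∀ {n} → Fin n → ℤ
  sgn i = signℤ (toℕ i)

  minor : ∀ {n} → Matrix (suc n) → Fin (suc n) → Matrix n
  minor M j i k = M (suc i) (punchIn j k)

  sumℤ≡sum : ∀ {n} (f : Fin n → ℤ) → sumℤ f ≡ sum f
  sumℤ≡sum {zero}  f = refl
  sumℤ≡sum {suc n} f = cong (λ s → f zero + s) (sumℤ≡sum (f ∘ suc))

  det-expand : ∀ n (M : Matrix (suc n)) → det (suc n) M ≡ sum (λ j → sgn j * M zero j * det n (minor M j))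
  det-expand n M = sumℤ≡sum (λ j → sgn j * M zero j * det n (minor M j))

  det-cong : ∀ n {M N : Matrix n} → (∀ i k → M i k ≡ N i k) → det n M ≡ det n N
  det-cong zero    _   = refl
  det-cong (suc n) {M} {N} M≗N = trans (det-expand n M) (trans (sum-cong-≗ term≗) (sym (det-expand n N)))
    where
    term≗ : ∀ j → sgn j * M zero j * det n (minor M j) ≡ sgn j * N zero j * det n (minor N j)
    term≗ j = cong₂ (λ x y → sgn j * x * y) (M≗N zero j) (det-cong n (λ i k → M≗N (suc i) (punchIn j k)))

  sgn-punchOut-anti : ∀ {n} {a b : Fin (suc n)} (a≢b : a ≢ b) (b≢a : b ≢ a) →
    sgn a * sgn (punchOut a≢b) ≡ - (sgn b * sgn (punchOut b≢a))
  sgn-punchOut-anti {a = zero} {zero} a≢b _ = contradiction refl a≢b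
  sgn-punchOut-anti {n = suc n} {zero} {suc b} _ _ = lemma (sgn b)
    where
    lemma : ∀ x → + 1 * x ≡ - (- x * + 1)
    lemma = solve-∀
  sgn-punchOut-anti {n = suc n} {suc a} {zero} _ _ = lemma (sgn a)
    where
    lemma : ∀ x → - x * + 1 ≡ - (+ 1 * x)
    lemma = solve-∀
  sgn-punchOut-anti {n = suc n} {suc a} {suc b} a≢b b≢a = begin
    - sgn a * - sgn (punchOut a≢b′)      ≡⟨ neg*neg (sgn a) _ ⟩
    sgn a * sgn (punchOut a≢b′)          ≡⟨ sgn-punchOut-anti a≢b′ b≢a′ ⟩
    - (sgn b * sgn (punchOut b≢a′))      ≡⟨ cong -_ (neg*neg (sgn b) _) ⟨
    - (- sgn b * - sgn (punchOut b≢a′))  ∎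
    where
    open ≡-Reasoning
    a≢b′ = a≢b ∘ cong suc
    b≢a′ = b≢a ∘ cong suc
    neg*neg : ∀ x y → - x * - y ≡ x * y
    neg*neg = solve-∀

  module _ {n : ℕ} (N : Fin n → Fin (suc (suc n)) → ℤ) where

    withRows : (R₀ R₁ : Fin (suc (suc n)) → ℤ) → Matrix (suc (suc n))
    withRows R₀ R₁ zero          = R₀
    withRows R₀ R₁ (suc zero)    = R₁
    withRows R₀ R₁ (suc (suc i)) = N i

    cofactor₂ : Fin (suc (suc n)) → Fin (suc n) → ℤ
    cofactor₂ a k = det n (λ i l → N i (punchIn a (punchIn k l)))

    -- The term of the expansion along rows 0 and 1 in which row 0 uses column
    -- a and row 1 uses column b.
    pairTerm : (R₀ R₁ : Fin (suc (suc n)) → ℤ) (a b : Fin (suc (suc n))) → ℤ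
    pairTerm R₀ R₁ a b with a ≟ b
    ... | yes _   = + 0
    ... | no  a≢b = sgn a * sgn (punchOut a≢b) * R₀ a * R₁ b * cofactor₂ a (punchOut a≢b)

    pairTerm-diag : ∀ R₀ R₁ a → pairTerm R₀ R₁ a a ≡ + 0
    pairTerm-diag R₀ R₁ a with a ≟ a
    ... | yes _   = refl
    ... | no  a≢a = contradiction refl a≢a

    pairTerm-punchIn : ∀ R₀ R₁ a k →
      pairTerm R₀ R₁ a (punchIn a k) ≡ sgn a * sgn k * R₀ a * R₁ (punchIn a k) * cofactor₂ a k
    pairTerm-punchIn R₀ R₁ a k with a ≟ punchIn a k
    ... | yes a≡a↑k = contradiction (sym a≡a↑k) (punchInᵢ≢i a k)
    ... | no  _     = cong (λ k′ → sgn a * sgn k′ * R₀ a * R₁ (punchIn a k) * cofactor₂ a k′)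
                           (trans (punchOut-cong a refl) (punchOut-punchIn a))

    pairTerm-anti : ∀ R₀ R₁ a b → pairTerm R₁ R₀ a b ≡ - pairTerm R₀ R₁ b a
    pairTerm-anti R₀ R₁ a b with a ≟ b | b ≟ a
    ... | yes _   | yes _   = refl
    ... | yes a≡b | no  b≢a = contradiction (sym a≡b) b≢a
    ... | no  a≢b | yes b≡a = contradiction (sym b≡a) a≢b
    ... | no  a≢b | no  b≢a = begin
      sgn a * sgn (punchOut a≢b) * R₁ a * R₀ b * cofactor₂ a (punchOut a≢b)
        ≡⟨ cong₂ (λ s d → s * R₁ a * R₀ b * d) (sgn-punchOut-anti a≢b b≢a)
                 (det-cong n (λ i l → cong (N i) (punchIn-punchOut-comm a≢b b≢a l))) ⟩
      - (sgn b * sgn (punchOut b≢a)) * R₁ a * R₀ b * cofactor₂ b (punchOut b≢a)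
        ≡⟨ rearrange (sgn b * sgn (punchOut b≢a)) (R₁ a) (R₀ b) _ ⟩
      - (sgn b * sgn (punchOut b≢a) * R₀ b * R₁ a * cofactor₂ b (punchOut b≢a)) ∎
      where
      open ≡-Reasoning
      rearrange : ∀ s x y d → - s * x * y * d ≡ - (s * y * x * d)
      rearrange = solve-∀

    det-withRows : ∀ R₀ R₁ → det (suc (suc n)) (withRows R₀ R₁) ≡ sum (λ a → sum (pairTerm R₀ R₁ a))
    det-withRows R₀ R₁ = trans (det-expand (suc n) (withRows R₀ R₁)) (sum-cong-≗ expand-row₁)
      where
      open ≡-Reasoning
      expand-row₁ : ∀ a → sgn a * R₀ a * det (suc n) (minor (withRows R₀ R₁) a) ≡ sum (pairTerm R₀ R₁ a)
      expand-row₁ a = begin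
        sgn a * R₀ a * det (suc n) (minor (withRows R₀ R₁) a)
          ≡⟨ cong (sgn a * R₀ a *_) (det-expand n (minor (withRows R₀ R₁) a)) ⟩
        sgn a * R₀ a * sum (λ k → sgn k * R₁ (punchIn a k) * cofactor₂ a k)
          ≡⟨ *-distribˡ-sum (sgn a * R₀ a) (λ k → sgn k * R₁ (punchIn a k) * cofactor₂ a k) ⟩
        sum (λ k → sgn a * R₀ a * (sgn k * R₁ (punchIn a k) * cofactor₂ a k))
          ≡⟨ sum-cong-≗ (λ k → trans (reassoc (sgn a) (R₀ a) (sgn k) (R₁ (punchIn a k)) (cofactor₂ a k))
                                     (sym (pairTerm-punchIn R₀ R₁ a k))) ⟩
        sum (λ k → pairTerm R₀ R₁ a (punchIn a k))
          ≡⟨ ℤ.+-identityˡ (sum (λ k → pairTerm R₀ R₁ a (punchIn a k))) ⟨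
        + 0 + sum (λ k → pairTerm R₀ R₁ a (punchIn a k))
          ≡⟨ cong (λ x → x + sum (λ k → pairTerm R₀ R₁ a (punchIn a k))) (pairTerm-diag R₀ R₁ a) ⟨
        pairTerm R₀ R₁ a a + sum (λ k → pairTerm R₀ R₁ a (punchIn a k))
          ≡⟨ sum-remove {i = a} (pairTerm R₀ R₁ a) ⟨
        sum (pairTerm R₀ R₁ a) ∎
        where
        reassoc : ∀ s x t y d → s * x * (t * y * d) ≡ s * t * x * y * d
        reassoc = solve-∀

    det-withRows-swap : ∀ R₀ R₁ → det (suc (suc n)) (withRows R₁ R₀) ≡ - det (suc (suc n)) (withRows R₀ R₁)
    det-withRows-swap R₀ R₁ = begin
      det (suc (suc n)) (withRows R₁ R₀)      ≡⟨ det-withRows R₁ R₀ ⟩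
      sum (λ a → sum (pairTerm R₁ R₀ a))     ≡⟨ sum-cong-≗ (λ a → sum-cong-≗ (pairTerm-anti R₀ R₁ a)) ⟩
      sum (λ a → sum (λ b → - T b a))        ≡⟨ sum-cong-≗ (λ a → neg-sum ℤ.+-*-ring (λ b → T b a)) ⟩
      sum (λ a → - sum (λ b → T b a))        ≡⟨ neg-sum ℤ.+-*-ring (λ a → sum (λ b → T b a)) ⟩
      - sum (λ a → sum (λ b → T b a))        ≡⟨ cong -_ (∑-comm (λ a b → T b a)) ⟩
      - sum (λ b → sum (T b))                ≡⟨ cong -_ (det-withRows R₀ R₁) ⟨
      - det (suc (suc n)) (withRows R₀ R₁)    ∎
      where
      open ≡-Reasoning
      T = pairTerm R₀ R₁

  lowerRows : ∀ {n} → Matrix (suc (suc n)) → Fin n → Fin (suc (suc n)) → ℤ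
  lowerRows M i = M (suc (suc i))

  swapRows₀₁ : ∀ {n} → Matrix (suc (suc n)) → Matrix (suc (suc n))
  swapRows₀₁ M = withRows (lowerRows M) (M (suc zero)) (M zero)

  det-swapRows₀₁ : ∀ n (M : Matrix (suc (suc n))) → det (suc (suc n)) (swapRows₀₁ M) ≡ - det (suc (suc n)) M
  det-swapRows₀₁ n M = trans (det-withRows-swap (lowerRows M) (M zero) (M (suc zero))) (cong -_ (det-cong _ rows))
    where
    rows : ∀ i k → withRows (lowerRows M) (M zero) (M (suc zero)) i k ≡ M i k
    rows zero          _ = refl
    rows (suc zero)    _ = refl
    rows (suc (suc i)) _ = refl

  x≡-x⇒x≡0 : ∀ {x : ℤ} → x ≡ - x → x ≡ + 0
  x≡-x⇒x≡0 {+ zero}    _  = refl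
  x≡-x⇒x≡0 {+[1+ _ ]}  ()
  x≡-x⇒x≡0 { -[1+ _ ]} ()

  mutual
    det-equalRows : ∀ n (M : Matrix n) {u v} → u ≢ v → (∀ k → M u k ≡ M v k) → det n M ≡ + 0
    det-equalRows (suc n) M {zero}  {zero}  0≢0 _     = contradiction refl 0≢0
    det-equalRows (suc n) M {zero}  {suc v} _   M₀≗Mv = det-equalRows-zero n M M₀≗Mv
    det-equalRows (suc n) M {suc u} {zero}  _   Mu≗M₀ = det-equalRows-zero n M (sym ∘ Mu≗M₀)
    det-equalRows (suc n) M {suc u} {suc v} u≢v Mu≗Mv = det-equalRows-suc n M (u≢v ∘ cong suc) Mu≗Mv

    det-equalRows-zero : ∀ n (M : Matrix (suc n)) {v} → (∀ k → M zero k ≡ M (suc v) k) → det (suc n) M ≡ + 0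
    det-equalRows-zero (suc n) M {zero} M₀≗M₁ = x≡-x⇒x≡0 (begin
      det (suc (suc n)) M                 ≡⟨ det-cong _ rows ⟩
      det (suc (suc n)) (swapRows₀₁ M)    ≡⟨ det-swapRows₀₁ n M ⟩
      - det (suc (suc n)) M               ∎)
      where
      open ≡-Reasoning
      rows : ∀ i k → M i k ≡ swapRows₀₁ M i k
      rows zero          k = M₀≗M₁ k
      rows (suc zero)    k = sym (M₀≗M₁ k)
      rows (suc (suc i)) k = refl
    det-equalRows-zero (suc n) M {suc v} M₀≗Mv = begin
      det (suc (suc n)) M                 ≡⟨ ℤ.neg-involutive _ ⟨
      - - det (suc (suc n)) M             ≡⟨ cong -_ (det-swapRows₀₁ n M) ⟨
      - det (suc (suc n)) (swapRows₀₁ M)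
        ≡⟨ cong -_ (det-equalRows-suc (suc n) (swapRows₀₁ M) {zero} {suc v} (λ ()) M₀≗Mv) ⟩
      + 0                                 ∎
      where open ≡-Reasoning

    det-equalRows-suc : ∀ n (M : Matrix (suc n)) {u v} → u ≢ v → (∀ k → M (suc u) k ≡ M (suc v) k) →
      det (suc n) M ≡ + 0
    det-equalRows-suc n M u≢v Mu≗Mv = begin
      det (suc n) M                                      ≡⟨ det-expand n M ⟩
      sum (λ j → sgn j * M zero j * det n (minor M j))   ≡⟨ sum-cong-≗ vanishes ⟩
      sum {suc n} (λ _ → + 0)                            ≡⟨ sum-replicate-zero (suc n) ⟩
      + 0                                                ∎
      where
      open ≡-Reasoning
      vanishes : ∀ j → sgn j * M zero j * det n (minor M j) ≡ + 0
      vanishes j = trans (cong (sgn j * M zero j *_) (det-equalRows n (minor M j) u≢v (Mu≗Mv ∘ punchIn j)))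
                         (ℤ.*-zeroʳ (sgn j * M zero j))

module EigenvalueZero {c ℓ} (K : Field c ℓ) where
  open Field K hiding (refl; sym; trans; zero)
  open FieldOps K
  open import Data.Fin.Properties using (_≟_)
  open import Relation.Nullary.Decidable using (dec-true; dec-false)
  open SemiringSum semiring using (sum; sum-cong-≋; ∑-distrib-+; sum-replicate-zero)
  open RingProperties ring using (-0#≈0#; x[y-z]≈xy-xz)
  open import Relation.Binary.Reasoning.Setoid setoid

  sumK≡sum : ∀ {n} (f : Fin n → Carrier) → sumK f ≡ sum f
  sumK≡sum {zero}  f = refl
  sumK≡sum {suc n} f = cong (f zero +_) (sumK≡sum (f ∘ suc))

  unitVector : ∀ {n} → Fin n → Fin n → Carrier
  unitVector a j = if does (j ≟ a) then 1# else 0#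

  unitVector-self : ∀ {n} (a : Fin n) → unitVector a a ≡ 1#
  unitVector-self a rewrite dec-true (a ≟ a) refl = refl

  unitVector-≢ : ∀ {n} {a j : Fin n} → j ≢ a → unitVector a j ≡ 0#
  unitVector-≢ {a = a} {j} j≢a rewrite dec-false (j ≟ a) j≢a = refl

  sum-*-unitVector : ∀ {n} (f : Fin n → Carrier) a → sum (λ j → f j * unitVector a j) ≈ f a
  sum-*-unitVector {suc n} f zero = begin
    f zero * 1# + sum (λ j → f (suc j) * 0#)  ≈⟨ +-cong (*-identityʳ (f zero)) (sum-cong-≋ (zeroʳ ∘ f ∘ suc)) ⟩
    f zero + sum {n} (λ _ → 0#)                ≈⟨ +-congˡ (sum-replicate-zero n) ⟩
    f zero + 0#                                ≈⟨ +-identityʳ (f zero) ⟩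
    f zero                                     ∎
  sum-*-unitVector {suc n} f (suc a) = begin
    f zero * 0# + sum (λ j → f (suc j) * unitVector a j)  ≈⟨ +-cong (zeroʳ (f zero)) (sum-*-unitVector (f ∘ suc) a) ⟩
    0# + f (suc a)                                        ≈⟨ +-identityˡ (f (suc a)) ⟩
    f (suc a)                                             ∎

  unitDiff : ∀ {n} → Fin n → Fin n → Fin n → Carrier
  unitDiff a b j = unitVector a j - unitVector b j

  mulMV-unitDiff : ∀ {n} (M : Fin n → Fin n → Carrier) a b i → mulMV M (unitDiff a b) i ≈ M i a - M i b
  mulMV-unitDiff M a b i = begin
    sumK (λ j → M i j * unitDiff a b j)
      ≡⟨ sumK≡sum (λ j → M i j * unitDiff a b j) ⟩
    sum (λ j → M i j * unitDiff a b j)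
      ≈⟨ sum-cong-≋ (λ j → x[y-z]≈xy-xz (M i j) (unitVector a j) (unitVector b j)) ⟩
    sum (λ j → M i j * unitVector a j + - (M i j * unitVector b j))
      ≈⟨ ∑-distrib-+ (λ j → M i j * unitVector a j) (λ j → - (M i j * unitVector b j)) ⟩
    sum (λ j → M i j * unitVector a j) + sum (λ j → - (M i j * unitVector b j))
      ≈⟨ +-congˡ (neg-sum ring (λ j → M i j * unitVector b j)) ⟩
    sum (λ j → M i j * unitVector a j) + - sum (λ j → M i j * unitVector b j)
      ≈⟨ +-cong (sum-*-unitVector (M i) a) (-‿cong (sum-*-unitVector (M i) b)) ⟩
    M i a - M i b
      ∎

  equalColumns⇒kernel : ∀ {n} (M : Fin n → Fin n → Carrier) {a b} → (∀ i → M i a ≈ M i b) →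
    InEigenspace M 0# (unitDiff a b)
  equalColumns⇒kernel M {a} {b} Ma≈Mb i = begin
    mulMV M (unitDiff a b) i   ≈⟨ mulMV-unitDiff M a b i ⟩
    M i a - M i b              ≈⟨ +-congʳ (Ma≈Mb i) ⟩
    M i b - M i b              ≈⟨ -‿inverseʳ (M i b) ⟩
    0#                         ≈⟨ zeroˡ (unitDiff a b i) ⟨
    0# * unitDiff a b i        ∎

  x[1-0]+y[0-0]≈x : ∀ x y → x * (1# - 0#) + y * (0# - 0#) ≈ x
  x[1-0]+y[0-0]≈x x y = begin
    x * (1# - 0#) + y * (0# - 0#)   ≈⟨ +-cong (*-congˡ (+-congˡ -0#≈0#)) (*-congˡ (-‿inverseʳ 0#)) ⟩
    x * (1# + 0#) + y * 0#          ≈⟨ +-cong (*-congˡ (+-identityʳ 1#)) (zeroʳ y) ⟩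
    x * 1# + 0#                     ≈⟨ +-identityʳ (x * 1#) ⟩
    x * 1#                          ≈⟨ *-identityʳ x ⟩
    x                               ∎

  unitDiffs-linIndep : ∀ {n} {a b c : Fin n} → b ≢ a → c ≢ a → b ≢ c → LinIndep₂ (unitDiff b a) (unitDiff c a)
  unitDiffs-linIndep {a = a} {b} {c} b≢a c≢a b≢c α β vanishes = α≈0 , β≈0
    where
    vanishes-at : ∀ j {x y} → unitDiff b a j ≡ x → unitDiff c a j ≡ y → α * x + β * y ≈ 0#
    vanishes-at j refl refl = vanishes j
    α≈0 : α ≈ 0#
    α≈0 = begin
      α                                ≈⟨ x[1-0]+y[0-0]≈x α β ⟨
      α * (1# - 0#) + β * (0# - 0#)    ≈⟨ vanishes-at b (cong₂ _-_ (unitVector-self b) (unitVector-≢ b≢a))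
                                                        (cong₂ _-_ (unitVector-≢ b≢c) (unitVector-≢ b≢a)) ⟩
      0#                               ∎
    β≈0 : β ≈ 0#
    β≈0 = begin
      β                                ≈⟨ x[1-0]+y[0-0]≈x β α ⟨
      β * (1# - 0#) + α * (0# - 0#)    ≈⟨ +-comm _ _ ⟩
      α * (0# - 0#) + β * (1# - 0#)    ≈⟨ vanishes-at c (cong₂ _-_ (unitVector-≢ (b≢c ∘ sym)) (unitVector-≢ c≢a))
                                                        (cong₂ _-_ (unitVector-self c) (unitVector-≢ c≢a)) ⟩
      0#                               ∎

  threeEqualColumns⇒multEigenvalue0 : ∀ {n} (M : Fin n → Fin n → Carrier) {a b c} → b ≢ a → c ≢ a → b ≢ c →
    (∀ i → M i b ≈ M i a) → (∀ i → M i c ≈ M i a) → MultEigenvalue M 0#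
  threeEqualColumns⇒multEigenvalue0 M b≢a c≢a b≢c Mb≈Ma Mc≈Ma =
    unitDiff _ _ , unitDiff _ _ , equalColumns⇒kernel M Mb≈Ma , equalColumns⇒kernel M Mc≈Ma ,
    unitDiffs-linIndep b≢a c≢a b≢c

module RationalField where
  open import Level using (0ℓ)
  open import Data.Rational using (0ℚ; 1ℚ; 1/_; ≢-nonZero) renaming (_≤_ to _≤ℚ_; _<_ to _<ℚ_)
  open import Data.Rational.Properties
    using (+-*-commutativeRing; *-inverseʳ; ≤-refl; <-irrefl; +-mono-≤; +-mono-<-≤; nonNegative⁻¹; positive⁻¹)

  ℚ-field : Field 0ℓ 0ℓ
  ℚ-field = record
    { commutativeRing = +-*-commutativeRing
    ; 1≉0             = λ ()
    ; inverse         = λ x x≢0 → let instance _ = ≢-nonZero x≢0 in 1/ x , *-inverseʳ x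
    }

  open FieldOps ℚ-field

  ×1-nonNegative : ∀ n → 0ℚ ≤ℚ n ×1
  ×1-nonNegative zero    = ≤-refl
  ×1-nonNegative (suc n) = +-mono-≤ (nonNegative⁻¹ 1ℚ) (×1-nonNegative n)

  ℚ-charZero : CharZero
  ℚ-charZero n n+1≡0 = <-irrefl refl (subst (0ℚ <ℚ_) n+1≡0 (+-mono-<-≤ (positive⁻¹ 1ℚ) (×1-nonNegative n)))

module ZeroDivisorGraph where
  open import Data.Nat using (_+_; _*_)
  import Data.Nat.Properties as ℕ
  open import Data.Nat.DivMod using (m<n⇒m%n≡m)
  open import Data.Nat.Tactic.RingSolver using (solve-∀)
  open import Data.Fin.Patterns using (0F; 1F; 2F; 3F)
  open import Data.Fin.Properties using (toℕ-injective; toℕ-fromℕ<; toℕ<n; _≟_)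
  open import Data.Vec using ([]; _∷_; lookup)
  open import Data.Bool using (false; not; _∧_)
  open import Data.Bool.Properties using (∧-zeroʳ)
  open import Function using (_⇔_; mk⇔; Equivalence)
  open import Function.Construct.Symmetry using (⇔-sym)
  open import Function.Construct.Composition using (_⇔-∘_)
  open import Relation.Nullary.Decidable using (dec-true; dec-false; does-⇔)

  module _ (p : ℕ) .{{_ : NonZero p}} where

    mulR-comm : ∀ a b → mulR p a b ≡ mulR p b a
    mulR-comm (a₀ ∷ a₁ ∷ a₂ ∷ a₃ ∷ []) (b₀ ∷ b₁ ∷ b₂ ∷ b₃ ∷ []) =
      cong₂ _∷_ (cong (⟦_⟧ p) (ℕ.*-comm (t a₀) (t b₀))) (
      cong₂ _∷_ (cong (⟦_⟧ p) (comm₁ (t a₀) (t a₁) (t b₀) (t b₁))) (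
      cong₂ _∷_ (cong (⟦_⟧ p) (comm₂ (t a₀) (t a₁) (t a₂) (t b₀) (t b₁) (t b₂))) (
      cong₂ _∷_ (cong (⟦_⟧ p) (comm₃ (t a₀) (t a₁) (t a₂) (t a₃) (t b₀) (t b₁) (t b₂) (t b₃))) refl)))
      where
      t : Fin p → ℕ
      t = toℕ
      comm₁ : ∀ a₀ a₁ b₀ b₁ → a₀ * b₁ + a₁ * b₀ ≡ b₀ * a₁ + b₁ * a₀
      comm₁ = solve-∀
      comm₂ : ∀ a₀ a₁ a₂ b₀ b₁ b₂ → a₀ * b₂ + a₁ * b₁ + a₂ * b₀ ≡ b₀ * a₂ + b₁ * a₁ + b₂ * a₀
      comm₂ = solve-∀
      comm₃ : ∀ a₀ a₁ a₂ a₃ b₀ b₁ b₂ b₃ →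
        a₀ * b₃ + a₁ * b₂ + a₂ * b₁ + a₃ * b₀ ≡ b₀ * a₃ + b₁ * a₂ + b₂ * a₁ + b₃ * a₀
      comm₃ = solve-∀

    adj-sym : ∀ {n} (e : Fin n → R p) i j → adj p e i j ≡ adj p e j i
    adj-sym e i j = cong₂ (λ x y → not x ∧ y)
      (does-⇔ (mk⇔ sym sym) (i ≟ j) (j ≟ i))
      (cong (λ z → does (_≟R_ p z (0R p))) (mulR-comm (e i) (e j)))

    adj-diag : ∀ {n} (e : Fin n → R p) i → adj p e i i ≡ false
    adj-diag e i rewrite dec-true (i ≟ i) refl = refl

    adj-≢ : ∀ {n} (e : Fin n → R p) {i j} → i ≢ j → adj p e i j ≡ does (_≟R_ p (mulR p (e i) (e j)) (0R p))
    adj-≢ e {i} {j} i≢j rewrite dec-false (i ≟ j) i≢j = refl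

    adj-nonzeroProduct : ∀ {n} (e : Fin n → R p) {i j} → mulR p (e i) (e j) ≢ 0R p → adj p e i j ≡ false
    adj-nonzeroProduct e {i} {j} eiej≢0 =
      trans (cong (not (does (i ≟ j)) ∧_) (dec-false (_≟R_ p _ _) eiej≢0)) (∧-zeroʳ _)

    sameAnnihilator⇒sameRow : ∀ {n} (e : Fin n → R p) {a b} →
      (∀ z → (mulR p (e a) z ≡ 0R p) ⇔ (mulR p (e b) z ≡ 0R p)) → mulR p (e a) (e b) ≢ 0R p →
      ∀ k → adj p e a k ≡ adj p e b k
    sameAnnihilator⇒sameRow e {a} {b} sameAnn eaeb≢0 k with k ≟ a | k ≟ b
    ... | yes refl | _        = trans (adj-diag e k) (sym (trans (adj-sym e b k) (adj-nonzeroProduct e eaeb≢0)))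
    ... | no _     | yes refl = trans (adj-nonzeroProduct e eaeb≢0) (sym (adj-diag e k))
    ... | no k≢a   | no k≢b   = begin
      adj p e a k                                 ≡⟨ adj-≢ e (k≢a ∘ sym) ⟩
      does (_≟R_ p (mulR p (e a) (e k)) (0R p))   ≡⟨ does-⇔ (sameAnn (e k)) (_≟R_ p _ _) (_≟R_ p _ _) ⟩
      does (_≟R_ p (mulR p (e b) (e k)) (0R p))   ≡⟨ adj-≢ e (k≢b ∘ sym) ⟨
      adj p e b k                                 ∎
      where open ≡-Reasoning

  module _ (q : ℕ) where

    private
      p : ℕ
      p = suc (suc q)

      t : Fin p → ℕ
      t = toℕ

    ⟦toℕ⟧ : ∀ {m} (f : Fin p) → m ≡ toℕ f → ⟦_⟧ p m ≡ f
    ⟦toℕ⟧ f refl = toℕ-injective (trans (toℕ-fromℕ< _) (m<n⇒m%n≡m (toℕ<n f)))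

    -- x + c·x² + d·x³ = x·(1 + c·x + d·x²), and the second factor is a unit.
    xTimesUnit : Fin p → Fin p → R p
    xTimesUnit c d = 0F ∷ 1F ∷ c ∷ d ∷ []

    x³ : R p
    x³ = 0F ∷ 0F ∷ 0F ∷ 1F ∷ []

    InX³ : R p → Set
    InX³ (z₀ ∷ z₁ ∷ z₂ ∷ _ ∷ []) = z₀ ≡ 0F × z₁ ≡ 0F × z₂ ≡ 0F

    mulR-xTimesUnit : ∀ c d z₀ z₁ z₂ z₃ → mulR p (xTimesUnit c d) (z₀ ∷ z₁ ∷ z₂ ∷ z₃ ∷ []) ≡
      0F ∷ z₀ ∷ ⟦_⟧ p (t z₁ + t c * t z₀) ∷ ⟦_⟧ p (t z₂ + t c * t z₁ + t d * t z₀) ∷ []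
    mulR-xTimesUnit c d z₀ z₁ z₂ z₃ =
      cong₂ _∷_ refl (cong₂ _∷_ (⟦toℕ⟧ z₀ (coeff₁ (t z₀) (t z₁))) (cong₂ _∷_
        (cong (⟦_⟧ p) (coeff₂ (t c) (t z₀) (t z₁) (t z₂)))
        (cong₂ _∷_ (cong (⟦_⟧ p) (coeff₃ (t c) (t d) (t z₀) (t z₁) (t z₂) (t z₃))) refl)))
      where
      coeff₁ : ∀ z₀ z₁ → 0 * z₁ + 1 * z₀ ≡ z₀
      coeff₁ = solve-∀
      coeff₂ : ∀ c z₀ z₁ z₂ → 0 * z₂ + 1 * z₁ + c * z₀ ≡ z₁ + c * z₀
      coeff₂ = solve-∀
      coeff₃ : ∀ c d z₀ z₁ z₂ z₃ → 0 * z₃ + 1 * z₂ + c * z₁ + d * z₀ ≡ z₂ + c * z₁ + d * z₀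
      coeff₃ = solve-∀

    annihilator-xTimesUnit : ∀ c d z → (mulR p (xTimesUnit c d) z ≡ 0R p) ⇔ InX³ z
    annihilator-xTimesUnit c d (z₀ ∷ z₁ ∷ z₂ ∷ z₃ ∷ []) =
      mk⇔ (to ∘ trans (sym product)) (trans product ∘ from)
      where
      product = mulR-xTimesUnit c d z₀ z₁ z₂ z₃
      Product : Fin p → Fin p → Fin p → R p
      Product z₀ z₁ z₂ = 0F ∷ z₀ ∷ ⟦_⟧ p (t z₁ + t c * t z₀) ∷ ⟦_⟧ p (t z₂ + t c * t z₁ + t d * t z₀) ∷ []
      drop₁ : ∀ z c → z + c * 0 ≡ z
      drop₁ = solve-∀
      drop₂ : ∀ z c d → z + c * 0 + d * 0 ≡ z
      drop₂ = solve-∀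
      to : ∀ {z₀ z₁ z₂} → Product z₀ z₁ z₂ ≡ 0R p → z₀ ≡ 0F × z₁ ≡ 0F × z₂ ≡ 0F
      to {suc _} ()
      to {0F} {z₁} {z₂} eq = refl , z₁≡0 , z₂≡0
        where
        z₁≡0 : z₁ ≡ 0F
        z₁≡0 = trans (sym (⟦toℕ⟧ z₁ (drop₁ (t z₁) (t c)))) (cong (λ v → lookup v 2F) eq)
        z₂≡0 : z₂ ≡ 0F
        z₂≡0 = trans (sym (⟦toℕ⟧ z₂ (trans (cong (λ m → t z₂ + t c * m + t d * 0) (cong toℕ z₁≡0))
                                            (drop₂ (t z₂) (t c) (t d)))))
                     (cong (λ v → lookup v 3F) eq)
      from : ∀ {z₀ z₁ z₂} → z₀ ≡ 0F × z₁ ≡ 0F × z₂ ≡ 0F → Product z₀ z₁ z₂ ≡ 0R p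
      from (refl , refl , refl) =
        cong₂ _∷_ refl (cong₂ _∷_ refl (cong₂ _∷_ (⟦toℕ⟧ 0F (drop₁ 0 (t c)))
          (cong₂ _∷_ (⟦toℕ⟧ 0F (drop₂ 0 (t c) (t d))) refl)))

    xTimesUnit-vertex : ∀ c d → IsVertex p (xTimesUnit c d)
    xTimesUnit-vertex c d =
      (λ ()) , x³ , (λ ()) , Equivalence.from (annihilator-xTimesUnit c d x³) (refl , refl , refl)

    xTimesUnit-product≢0 : ∀ c d c′ d′ → mulR p (xTimesUnit c d) (xTimesUnit c′ d′) ≢ 0R p
    xTimesUnit-product≢0 c d c′ d′ uw≡0 with Equivalence.to (annihilator-xTimesUnit c d (xTimesUnit c′ d′)) uw≡0
    ... | _ , () , _

    module Enumerated {n} (e : Fin n → R p) (enum : Enumerates p n e) where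

      index : Fin p → Fin p → Fin n
      index c d = proj₁ (proj₂ (proj₂ enum) (xTimesUnit c d) (xTimesUnit-vertex c d))

      e∘index : ∀ c d → e (index c d) ≡ xTimesUnit c d
      e∘index c d = proj₂ (proj₂ (proj₂ enum) (xTimesUnit c d) (xTimesUnit-vertex c d))

      index-≢ : ∀ {c d c′ d′} → xTimesUnit c d ≢ xTimesUnit c′ d′ → index c d ≢ index c′ d′
      index-≢ {c} {d} {c′} {d′} u≢w i≡j = u≢w (trans (sym (e∘index c d)) (trans (cong e i≡j) (e∘index c′ d′)))

      index-sameRow : ∀ c d c′ d′ k → adj p e (index c d) k ≡ adj p e (index c′ d′) k
      index-sameRow c d c′ d′ = sameAnnihilator⇒sameRow p e sameAnn product≢0
        where
        sameAnn : ∀ z → (mulR p (e (index c d)) z ≡ 0R p) ⇔ (mulR p (e (index c′ d′)) z ≡ 0R p)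
        sameAnn z rewrite e∘index c d | e∘index c′ d′ =
          ⇔-sym (annihilator-xTimesUnit c′ d′ z) ⇔-∘ annihilator-xTimesUnit c d z
        product≢0 : mulR p (e (index c d)) (e (index c′ d′)) ≢ 0R p
        product≢0 rewrite e∘index c d | e∘index c′ d′ = xTimesUnit-product≢0 c d c′ d′

      index-sameColumn : ∀ c d c′ d′ k → adj p e k (index c d) ≡ adj p e k (index c′ d′)
      index-sameColumn c d c′ d′ k =
        trans (adj-sym p e k _) (trans (index-sameRow c d c′ d′ k) (adj-sym p e _ k))

open Determinant using (det-equalRows)
open EigenvalueZero using (threeEqualColumns⇒multEigenvalue0)
open RationalField using (ℚ-field; ℚ-charZero)
open import Data.Integer using (+_)
open import Data.Fin.Patterns using (0F; 1F)
open import Data.Rational using (0ℚ; 1ℚ)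

-- p ≤ 1 needs no clause (NonZero 0 and Prime 1 are empty types).
mainTheorem2 : (p : ℕ) .{{_ : NonZero p}} → Prime p →
    (n : ℕ) (e : Fin n → R p) → Enumerates p n e →
    (det n (adjMatrixℤ p e) ≡ + 0) × (3 ≤ p → HasMultipleEigenvalue p e)
mainTheorem2 (suc (suc q)) _ n e enum =
  det-equalRows n (adjMatrixℤ p e) (index-≢ λ ()) (cong toℤ ∘ index-sameRow 0F 0F 0F 1F) ,
  λ _ → ℚ-field , ℚ-charZero , 0ℚ ,
    threeEqualColumns⇒multEigenvalue0 ℚ-field (adjMatrixK ℚ-field p e)
      (index-≢ λ ()) (index-≢ λ ()) (index-≢ λ ())
      (cong toℚ ∘ index-sameColumn 0F 1F 0F 0F) (cong toℚ ∘ index-sameColumn 1F 0F 0F 0F)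
  where
  p = suc (suc q)
  open ZeroDivisorGraph.Enumerated q e enum
  toℤ = λ b → if b then + 1 else + 0
  toℚ = λ b → if b then 1ℚ else 0ℚ
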